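{- Fix integers $k\geq 1$ and $\beta\geq 0$. Let $G$ be an $F_k$-free graph with a partition $V(G)=X\cup Y$, and suppose that every edge $xx'$ of $G[X]$ satisfies $|N_G(x)\cap N_G(x')\cap Y|\ge |Y|-\beta$. If $|Y|$ is sufficiently large in terms of $k$ and $\beta$, then $e(G[X])\le f(k-1,k-1)$. The symmetric bound holds for $G[Y]$ (with $X$ and $Y$ interchanged in the hypotheses).
   Context: The friendship graph $F_k$ consists of $k$ triangles sharing one common vertex; $F_k$-free means containing no copy of $F_k$ as a subgraph. $\nu(H)$ is the matching number and $\Delta(H)$ the maximum degree. $f(\nu,\Delta)=\max\{e(H):\nu(H)\le\nu,\ \Delta(H)\le\Delta\}$. -}

module Defs where

open import Data.Nat using (ℕ; zero; suc; _+_; _*_; _∸_; _≤_; _<_)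
open import Data.Bool using (Bool; true; false; not; _∧_)
open import Data.Fin using (Fin; toℕ)
import Data.Nat
open import Data.Bool.Properties using () renaming (_≟_ to _≟ᵇ_)
open import Data.List using (List; length; filter; allFin; concatMap; map)
open import Data.Product using (Σ; ∃; ∃-syntax; _×_; _,_)
open import Relation.Binary.PropositionalEquality using (_≡_; _≢_)
open import Relation.Nullary using (¬_)
open import Function.Definitions using (Injective)
open import Function using (_∘_)

record Graph (n : ℕ) : Set where
  field
    adj    : Fin n → Fin n → Bool
    sym    : ∀ u v → adj u v ≡ adj v u
    irrefl : ∀ v → adj v v ≡ false
open Graph public

_≡ᵇ_ : Bool → Bool → Bool
true  ≡ᵇ b = b
false ≡ᵇ b = not b

count : ∀ {n} → (Fin n → Bool) → ℕ
count {n} p = length (filter (λ v → p v ≟ᵇ true) (allFin n))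

pairs : ∀ n → List (Fin n × Fin n)
pairs n = concatMap (λ u → map (u ,_) (allFin n)) (allFin n)

_<ᵇ_ : ∀ {n} → Fin n → Fin n → Bool
u <ᵇ v = Data.Nat._<ᵇ_ (toℕ u) (toℕ v)

countPairs : ∀ {n} → (Fin n → Fin n → Bool) → ℕ
countPairs {n} p =
  length (filter (λ { (u , v) → ((u <ᵇ v) ∧ p u v) ≟ᵇ true }) (pairs n))

e : ∀ {n} → Graph n → ℕ
e G = countPairs (adj G)

eInduced : ∀ {n} → Graph n → (Fin n → Bool) → ℕ
eInduced G S = countPairs (λ u v → S u ∧ S v ∧ adj G u v)

deg : ∀ {n} → Graph n → Fin n → ℕ
deg G v = count (adj G v)

MaxDegLe : ∀ {n} → Graph n → ℕ → Set
MaxDegLe G D = ∀ v → deg G v ≤ D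

record Matching {n} (G : Graph n) (m : ℕ) : Set where
  field
    u w     : Fin m → Fin n
    edge    : ∀ i → adj G (u i) (w i) ≡ true
    u-inj   : Injective _≡_ _≡_ u
    w-inj   : Injective _≡_ _≡_ w
    u≢w     : ∀ i j → u i ≢ w j

MatchingNumberLe : ∀ {n} → Graph n → ℕ → Set
MatchingNumberLe G ν = ¬ Matching G (suc ν)

Bounded : ℕ → ℕ → ∀ {n} → Graph n → Set
Bounded ν D H = MatchingNumberLe H ν × MaxDegLe H D

-- "m = f(ν , D)" : m is the maximum of e(H) over all finite simple
-- graphs H with ν(H) ≤ ν and Δ(H) ≤ D  (attained, and an upper bound).
IsF : ℕ → ℕ → ℕ → Set
IsF ν D m =
  (Σ ℕ λ n → Σ (Graph n) λ H → Bounded ν D H × e H ≡ m)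
  × (∀ n (H : Graph n) → Bounded ν D H → e H ≤ m)

-- A copy of the friendship graph F_k (k triangles sharing one vertex)
-- in G: centre c, and triangles c (a i) (b i), all 2k+1 vertices distinct.
record FriendshipCopy {n} (G : Graph n) (k : ℕ) : Set where
  field
    c     : Fin n
    a b   : Fin k → Fin n
    a-inj : Injective _≡_ _≡_ a
    b-inj : Injective _≡_ _≡_ b
    a≢b   : ∀ i j → a i ≢ b j
    c≢a   : ∀ i → c ≢ a i
    c≢b   : ∀ i → c ≢ b i
    ca    : ∀ i → adj G c (a i) ≡ true
    cb    : ∀ i → adj G c (b i) ≡ true
    ab    : ∀ i → adj G (a i) (b i) ≡ true

FkFree : ∀ {n} → ℕ → Graph n → Set
FkFree k G = ¬ FriendshipCopy G k

commonNbrsIn : ∀ {n} → Graph n → (Fin n → Bool) → Fin n → Fin n → ℕ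
commonNbrsIn G Y x x' = count (λ y → Y y ∧ adj G x y ∧ adj G x' y)

{-# OPTIONS --safe #-}
module Submission where

-- An edge of G[X] has all but at most β vertices of Y as common neighbours, so by the union
-- bound any k edges of G[X] have at least |Y| − kβ common neighbours in Y, hence at least k of
-- them once |Y| ≥ k + kβ.  If G[X] had a matching of size k, one common neighbour c of its
-- 2k endpoints would be the centre of an F_k.  If a vertex v had k neighbours a_i in G[X],
-- k distinct common neighbours b_i of the edges v a_i would give the F_k with triangles
-- v a_i b_i.  So ν(G[X]) ≤ k − 1 and Δ(G[X]) ≤ k − 1, whence e(G[X]) ≤ f(k − 1, k − 1).

open import Defs
open import Data.Nat using (ℕ; _≤_; _∸_)
open import Data.Bool using (Bool; true; not)
open import Data.Fin using (Fin)
open import Data.Product using (Σ)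
open import Relation.Binary.PropositionalEquality using (_≡_)

open import Data.Nat using (zero; suc; _+_; _*_; _<_; z≤n; s≤s)
open import Data.Nat.Properties
  using (+-0-commutativeMonoid; +-mono-≤; +-monoʳ-≤; +-comm; +-cancelˡ-≤;
         ∸-monoʳ-≤; m+n∸n≡m; m≤n+m∸n; m+n≤o⇒m≤o∸n; m≤n+m; ≤-trans; ≤-pred; ≰⇒>;
         ≤-refl; ≤-reflexive; module ≤-Reasoning)
open import Data.Bool using (false; _∧_; _∨_)
open import Data.Bool.Properties
  using (∧-conicalˡ; ∧-conicalʳ; ∧-zeroʳ; ∧-distribˡ-∨; not-¬; ∨-∧-booleanAlgebra;
         ∧-commutativeMonoid)
  renaming (_≟_ to _≟ᵇ_)
open import Data.Fin using (zero; suc)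
open import Data.Fin.Properties using (suc-injective)
open import Data.List using (length; filter; tabulate)
open import Data.Vec.Functional using (foldr; _∷_)
open import Data.Product using (_×_; _,_; proj₁; proj₂; Σ-syntax)
open import Data.Empty using (⊥)
open import Function using (_∘_; const)
open import Function.Definitions using (Injective)
open import Relation.Nullary using (¬_)
open import Relation.Binary.PropositionalEquality using (refl; cong; cong₂; subst; _≢_)
import Relation.Binary.PropositionalEquality as ≡
open import Algebra.Properties.CommutativeMonoid.Sum +-0-commutativeMonoid
  using (sum-syntax; ∑-distrib-+; sum-cong-≗; sum-replicate-zero)
open import Algebra.Lattice.Properties.BooleanAlgebra ∨-∧-booleanAlgebra using (deMorgan₁)
open import Algebra.Bundles using (module CommutativeMonoid)
open import Algebra.Properties.CommutativeSemigroup
  (CommutativeMonoid.commutativeSemigroup ∧-commutativeMonoid)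
  using (x∙yz≈y∙xz)

m+n∸o≤m⇒n≤o : ∀ m n o → m + n ∸ o ≤ m → n ≤ o
m+n∸o≤m⇒n≤o m n o m+n∸o≤m = +-cancelˡ-≤ m n o (begin
  m + n            ≤⟨ m≤n+m∸n (m + n) o ⟩
  o + (m + n ∸ o)  ≤⟨ +-monoʳ-≤ o m+n∸o≤m ⟩
  o + m            ≡⟨ +-comm o m ⟩
  m + o            ∎)
  where open ≤-Reasoning

indicator : Bool → ℕ
indicator true  = 1
indicator false = 0

count≡∑ : ∀ {n} (p : Fin n → Bool) → count p ≡ ∑[ v < n ] indicator (p v)
count≡∑ {n} p = length-filter-tabulate (λ v → v)
  where
  length-filter-tabulate : ∀ {m} (f : Fin m → Fin n) →
    length (filter (λ v → p v ≟ᵇ true) (tabulate f)) ≡ ∑[ i < m ] indicator (p (f i))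
  length-filter-tabulate {zero}  f = refl
  length-filter-tabulate {suc m} f with p (f zero)
  ... | true  = cong suc (length-filter-tabulate (f ∘ suc))
  ... | false = length-filter-tabulate (f ∘ suc)

∑-mono-≤ : ∀ {n} {f g : Fin n → ℕ} → (∀ i → f i ≤ g i) → ∑[ i < n ] f i ≤ ∑[ i < n ] g i
∑-mono-≤ {zero}  f≤g = z≤n
∑-mono-≤ {suc n} f≤g = +-mono-≤ (f≤g zero) (∑-mono-≤ (f≤g ∘ suc))

module _ {n : ℕ} where

  count-cong : {p q : Fin n → Bool} → (∀ v → p v ≡ q v) → count p ≡ count q
  count-cong {p} {q} p≗q = begin
    count p                     ≡⟨ count≡∑ p ⟩
    ∑[ v < n ] indicator (p v)  ≡⟨ sum-cong-≗ (cong indicator ∘ p≗q) ⟩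
    ∑[ v < n ] indicator (q v)  ≡⟨ count≡∑ q ⟨
    count q                     ∎
    where open ≡.≡-Reasoning

  count-none : {p : Fin n → Bool} → (∀ v → p v ≡ false) → count p ≡ 0
  count-none p≗false =
    ≡.trans (count-cong p≗false) (≡.trans (count≡∑ {n} (const false)) (sum-replicate-zero n))

  count-split : (p q : Fin n → Bool) →
    count p ≡ count (λ v → p v ∧ q v) + count (λ v → p v ∧ not (q v))
  count-split p q = begin
    count p
      ≡⟨ count≡∑ p ⟩
    ∑[ v < n ] indicator (p v)
      ≡⟨ sum-cong-≗ (λ v → split (p v) (q v)) ⟩
    ∑[ v < n ] (indicator (p v ∧ q v) + indicator (p v ∧ not (q v)))
      ≡⟨ ∑-distrib-+ (λ v → indicator (p v ∧ q v)) (λ v → indicator (p v ∧ not (q v))) ⟩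
    ∑[ v < n ] indicator (p v ∧ q v) + ∑[ v < n ] indicator (p v ∧ not (q v))
      ≡⟨ cong₂ _+_ (count≡∑ (λ v → p v ∧ q v)) (count≡∑ (λ v → p v ∧ not (q v))) ⟨
    count (λ v → p v ∧ q v) + count (λ v → p v ∧ not (q v))
      ∎
    where
    open ≡.≡-Reasoning
    split : ∀ a b → indicator a ≡ indicator (a ∧ b) + indicator (a ∧ not b)
    split false b     = refl
    split true  true  = refl
    split true  false = refl

  count-∨ : (p q : Fin n → Bool) → count (λ v → p v ∨ q v) ≤ count p + count q
  count-∨ p q = begin
    count (λ v → p v ∨ q v)
      ≡⟨ count≡∑ (λ v → p v ∨ q v) ⟩
    ∑[ v < n ] indicator (p v ∨ q v)
      ≤⟨ ∑-mono-≤ (λ v → indicator-∨ (p v) (q v)) ⟩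
    ∑[ v < n ] (indicator (p v) + indicator (q v))
      ≡⟨ ∑-distrib-+ (indicator ∘ p) (indicator ∘ q) ⟩
    ∑[ v < n ] indicator (p v) + ∑[ v < n ] indicator (q v)
      ≡⟨ cong₂ _+_ (count≡∑ p) (count≡∑ q) ⟨
    count p + count q
      ∎
    where
    open ≤-Reasoning
    indicator-∨ : ∀ a b → indicator (a ∨ b) ≤ indicator a + indicator b
    indicator-∨ false b = ≤-refl
    indicator-∨ true  b = s≤s z≤n

count-suc : ∀ {n} (p : Fin (suc n) → Bool) → count p ≡ indicator (p zero) + count (p ∘ suc)
count-suc p = ≡.trans (count≡∑ p) (cong (indicator (p zero) +_) (≡.sym (count≡∑ (p ∘ suc))))

choose : ∀ {n} m (p : Fin n → Bool) → m ≤ count p →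
  Σ[ f ∈ (Fin m → Fin n) ] Injective _≡_ _≡_ f × (∀ i → p (f i) ≡ true)
choose zero p _ = (λ ()) , (λ { {()} }) , (λ ())
choose {suc n} (suc m) p m<count with p zero in p₀ | subst (suc m ≤_) (count-suc p) m<count
... | true  | m<1+count = let (f , f-inj , pf) = choose m (p ∘ suc) (≤-pred m<1+count) in
  (zero ∷ suc ∘ f) , zero∷suc-injective f-inj , λ { zero → p₀ ; (suc i) → pf i }
  where
  zero∷suc-injective : ∀ {f : Fin m → Fin n} →
    Injective _≡_ _≡_ f → Injective _≡_ _≡_ (zero ∷ suc ∘ f)
  zero∷suc-injective f-inj {zero}  {zero}  _  = refl
  zero∷suc-injective f-inj {suc i} {suc j} eq = cong suc (f-inj (suc-injective eq))
... | false | m<count′ = let (f , f-inj , pf) = choose (suc m) (p ∘ suc) m<count′ in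
  suc ∘ f , f-inj ∘ suc-injective , pf

witness : ∀ {n} {p : Fin n → Bool} → 0 < count p → Σ[ v ∈ Fin n ] p v ≡ true
witness {p = p} 0<count = let (f , _ , pf) = choose 1 p 0<count in f zero , pf zero

⋀ : ∀ {k} → (Fin k → Bool) → Bool
⋀ = foldr _∧_ true

⋀-true : ∀ {k} (b : Fin k → Bool) → ⋀ b ≡ true → ∀ i → b i ≡ true
⋀-true b all zero    = ∧-conicalˡ (b zero) _ all
⋀-true b all (suc i) = ⋀-true (b ∘ suc) (∧-conicalʳ (b zero) _ all) i

count-∧-not-⋀-≤ : ∀ {k n} β (Y : Fin n → Bool) (q : Fin k → Fin n → Bool) →
  (∀ i → count (λ v → Y v ∧ not (q i v)) ≤ β) →
  count (λ v → Y v ∧ not (⋀ λ i → q i v)) ≤ k * β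
count-∧-not-⋀-≤ {zero}      β Y q _      = ≤-reflexive (count-none (λ v → ∧-zeroʳ (Y v)))
count-∧-not-⋀-≤ {suc k} {n} β Y q misses = begin
  count (λ v → Y v ∧ not (q zero v ∧ rest v))
    ≡⟨ count-cong (λ v → ≡.trans (cong (Y v ∧_) (deMorgan₁ (q zero v) (rest v)))
                                  (∧-distribˡ-∨ (Y v) (not (q zero v)) (not (rest v)))) ⟩
  count (λ v → (Y v ∧ not (q zero v)) ∨ (Y v ∧ not (rest v)))
    ≤⟨ count-∨ (λ v → Y v ∧ not (q zero v)) (λ v → Y v ∧ not (rest v)) ⟩
  count (λ v → Y v ∧ not (q zero v)) + count (λ v → Y v ∧ not (rest v))
    ≤⟨ +-mono-≤ (misses zero) (count-∧-not-⋀-≤ β Y (q ∘ suc) (misses ∘ suc)) ⟩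
  β + k * β
    ∎
  where
  open ≤-Reasoning
  rest : Fin n → Bool
  rest v = ⋀ λ i → q (suc i) v

count-∧-⋀-≥ : ∀ {k n} β (Y : Fin n → Bool) (q : Fin k → Fin n → Bool) →
  (∀ i → count Y ∸ β ≤ count (λ v → Y v ∧ q i v)) →
  count Y ∸ k * β ≤ count (λ v → Y v ∧ ⋀ (λ i → q i v))
count-∧-⋀-≥ {k} {n} β Y q few-misses = begin
  count Y ∸ k * β
    ≡⟨ cong (_∸ k * β) (count-split Y all-q) ⟩
  hits all-q + misses all-q ∸ k * β
    ≤⟨ ∸-monoʳ-≤ (hits all-q + misses all-q) (count-∧-not-⋀-≤ β Y q misses≤β) ⟩
  hits all-q + misses all-q ∸ misses all-q
    ≡⟨ m+n∸n≡m (hits all-q) (misses all-q) ⟩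
  hits all-q
    ∎
  where
  open ≤-Reasoning
  all-q : Fin n → Bool
  all-q v = ⋀ λ i → q i v
  hits misses : (Fin n → Bool) → ℕ
  hits   r = count (λ v → Y v ∧ r v)
  misses r = count (λ v → Y v ∧ not (r v))
  misses≤β : ∀ i → misses (q i) ≤ β
  misses≤β i = m+n∸o≤m⇒n≤o (hits (q i)) (misses (q i)) β
    (subst (λ c → c ∸ β ≤ hits (q i)) (count-split Y (q i)) (few-misses i))

induced : ∀ {n} → Graph n → (Fin n → Bool) → Graph n
induced G S = record
  { adj    = λ u v → S u ∧ S v ∧ adj G u v
  ; sym    = λ u v → ≡.trans (cong (λ a → S u ∧ S v ∧ a) (sym G u v))
                             (x∙yz≈y∙xz (S u) (S v) (adj G v u))
  ; irrefl = λ v → ≡.trans (cong (λ a → S v ∧ S v ∧ a) (irrefl G v))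
                           (≡.trans (cong (S v ∧_) (∧-zeroʳ (S v))) (∧-zeroʳ (S v)))
  }

induced-adj : ∀ {n} (G : Graph n) (S : Fin n → Bool) {u v} → adj (induced G S) u v ≡ true →
  S u ≡ true × S v ≡ true × adj G u v ≡ true
induced-adj G S {u} {v} uv =
  ∧-conicalˡ (S u) _ uv , ∧-conicalˡ (S v) _ vuv , ∧-conicalʳ (S v) _ vuv
  where
  vuv : S v ∧ adj G u v ≡ true
  vuv = ∧-conicalʳ (S u) _ uv

adj⇒≢ : ∀ {n} (G : Graph n) {u v} → adj G u v ≡ true → u ≢ v
adj⇒≢ G {u} uu refl with () ← ≡.trans (≡.sym uu) (irrefl G u)

module Codegree {n} (G : Graph n) (X Y : Fin n → Bool)
  (X∩Y≡∅ : ∀ {v} → X v ≡ true → Y v ≡ true → ⊥) (β : ℕ)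
  (codegree : ∀ {x x'} → adj (induced G X) x x' ≡ true → count Y ∸ β ≤ commonNbrsIn G Y x x')
  where

  X≢Y : ∀ {u v} → X u ≡ true → Y v ≡ true → u ≢ v
  X≢Y Xu Yv refl = X∩Y≡∅ Xu Yv

  commonNbrsOfEdges : ∀ {k} → (Fin k → Fin n) → (Fin k → Fin n) → Fin n → Bool
  commonNbrsOfEdges x x' v = Y v ∧ ⋀ (λ i → adj G (x i) v ∧ adj G (x' i) v)

  module _ {k} (x x' : Fin k → Fin n) {v : Fin n} (common : commonNbrsOfEdges x x' v ≡ true) where

    commonNbr-Y : Y v ≡ true
    commonNbr-Y = ∧-conicalˡ (Y v) _ common

    private
      adj-both : ∀ i → adj G (x i) v ∧ adj G (x' i) v ≡ true
      adj-both = ⋀-true _ (∧-conicalʳ (Y v) _ common)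

    commonNbr-adjˡ : ∀ i → adj G (x i) v ≡ true
    commonNbr-adjˡ i = ∧-conicalˡ _ _ (adj-both i)

    commonNbr-adjʳ : ∀ i → adj G (x' i) v ≡ true
    commonNbr-adjʳ i = ∧-conicalʳ _ _ (adj-both i)

  many-commonNbrsOfEdges : ∀ {k} m (x x' : Fin k → Fin n) →
    (∀ i → adj (induced G X) (x i) (x' i) ≡ true) → m + k * β ≤ count Y →
    m ≤ count (commonNbrsOfEdges x x')
  many-commonNbrsOfEdges m x x' edges large =
    ≤-trans (m+n≤o⇒m≤o∸n m large) (count-∧-⋀-≥ β Y _ (λ i → codegree (edges i)))

  module _ {k} (Fk-free : FkFree k G) where

    induced-no-matching : k * β < count Y → ¬ Matching (induced G X) k
    induced-no-matching large M = Fk-free record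
      { c = c ; a = u ; b = w ; a-inj = u-inj ; b-inj = w-inj ; a≢b = u≢w
      ; c≢a = λ i c≡u → X≢Y (proj₁ (ends i)) Yc (≡.sym c≡u)
      ; c≢b = λ i c≡w → X≢Y (proj₁ (proj₂ (ends i))) Yc (≡.sym c≡w)
      ; ca  = λ i → ≡.trans (sym G c (u i)) (commonNbr-adjˡ u w c-common i)
      ; cb  = λ i → ≡.trans (sym G c (w i)) (commonNbr-adjʳ u w c-common i)
      ; ab  = λ i → proj₂ (proj₂ (ends i))
      }
      where
      open Matching M
      ends : ∀ i → X (u i) ≡ true × X (w i) ≡ true × adj G (u i) (w i) ≡ true
      ends i = induced-adj G X (edge i)
      apex : Σ[ v ∈ Fin n ] commonNbrsOfEdges u w v ≡ true
      apex = witness (many-commonNbrsOfEdges 1 u w edge large)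
      c : Fin n
      c = proj₁ apex
      c-common : commonNbrsOfEdges u w c ≡ true
      c-common = proj₂ apex
      Yc : Y c ≡ true
      Yc = commonNbr-Y u w c-common

    induced-deg< : k + k * β ≤ count Y → ∀ v → deg (induced G X) v < k
    induced-deg< large v = ≰⇒> (Fk-free ∘ friendship-at-v)
      where
      friendship-at-v : k ≤ deg (induced G X) v → FriendshipCopy G k
      friendship-at-v k≤deg = record
        { c = v ; a = a ; b = b ; a-inj = a-inj ; b-inj = b-inj
        ; a≢b = λ i j → X≢Y (proj₁ (proj₂ (ends i))) (commonNbr-Y (const v) a (b-common j))
        ; c≢a = λ i → adj⇒≢ G (proj₂ (proj₂ (ends i)))
        ; c≢b = λ i → X≢Y (proj₁ (ends i)) (commonNbr-Y (const v) a (b-common i))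
        ; ca  = λ i → proj₂ (proj₂ (ends i))
        ; cb  = λ i → commonNbr-adjˡ (const v) a (b-common i) i
        ; ab  = λ i → commonNbr-adjʳ (const v) a (b-common i) i
        }
        where
        nbrs : Σ[ a ∈ (Fin k → Fin n) ]
                 Injective _≡_ _≡_ a × (∀ i → adj (induced G X) v (a i) ≡ true)
        nbrs = choose k (adj (induced G X) v) k≤deg
        a : Fin k → Fin n
        a = proj₁ nbrs
        a-inj : Injective _≡_ _≡_ a
        a-inj = proj₁ (proj₂ nbrs)
        ends : ∀ i → X v ≡ true × X (a i) ≡ true × adj G v (a i) ≡ true
        ends i = induced-adj G X (proj₂ (proj₂ nbrs) i)
        tips : Σ[ b ∈ (Fin k → Fin n) ]
                 Injective _≡_ _≡_ b × (∀ i → commonNbrsOfEdges (const v) a (b i) ≡ true)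
        tips = choose k _ (many-commonNbrsOfEdges k (const v) a (proj₂ (proj₂ nbrs)) large)
        b : Fin k → Fin n
        b = proj₁ tips
        b-inj : Injective _≡_ _≡_ b
        b-inj = proj₁ (proj₂ tips)
        b-common : ∀ i → commonNbrsOfEdges (const v) a (b i) ≡ true
        b-common = proj₂ (proj₂ tips)

  induced-bounded : ∀ {k} → FkFree (suc k) G → suc k + suc k * β ≤ count Y →
    Bounded k k (induced G X)
  induced-bounded {k} Fk-free large =
    induced-no-matching Fk-free (≤-trans (s≤s (m≤n+m (suc k * β) k)) large) ,
    ≤-pred ∘ induced-deg< Fk-free large

≡ᵇ⇒≡ : ∀ {a b} → (a ≡ᵇ b) ≡ true → a ≡ b
≡ᵇ⇒≡ {true}  {true}  _ = refl
≡ᵇ⇒≡ {false} {false} _ = refl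

partition-bounded : ∀ {n k} β (G : Graph n) (P : Fin n → Bool) (s : Bool) → FkFree (suc k) G →
  (∀ x x' → P x ≡ s → P x' ≡ s → adj G x x' ≡ true →
    count (λ y → P y ≡ᵇ not s) ∸ β ≤ commonNbrsIn G (λ y → P y ≡ᵇ not s) x x') →
  suc k + suc k * β ≤ count (λ y → P y ≡ᵇ not s) →
  Bounded k k (induced G (λ v → P v ≡ᵇ s))
partition-bounded {n} β G P s Fk-free codegree =
  Codegree.induced-bounded G X Y X∩Y≡∅ β codegree-X Fk-free
  where
  X Y : Fin n → Bool
  X v = P v ≡ᵇ s
  Y v = P v ≡ᵇ not s
  X∩Y≡∅ : ∀ {v} → X v ≡ true → Y v ≡ true → ⊥
  X∩Y≡∅ {v} Xv Yv = not-¬ (≡ᵇ⇒≡ {P v} Xv) (≡ᵇ⇒≡ {P v} Yv)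
  codegree-X : ∀ {x x'} → adj (induced G X) x x' ≡ true → count Y ∸ β ≤ commonNbrsIn G Y x x'
  codegree-X {x} {x'} xx' with Xx , Xx' , xx'∈G ← induced-adj G X xx' =
    codegree x x' (≡ᵇ⇒≡ {P x} Xx) (≡ᵇ⇒≡ {P x'} Xx') xx'∈G

corollary4p4 :
    (k β : ℕ) → 1 ≤ k →
    Σ ℕ λ N →
      ∀ n (G : Graph n) (P : Fin n → Bool) (s : Bool) →
      FkFree k G →
      (∀ x x' → P x ≡ s → P x' ≡ s → adj G x x' ≡ true →
        count (λ y → P y ≡ᵇ not s) ∸ β ≤ commonNbrsIn G (λ y → P y ≡ᵇ not s) x x') →
      N ≤ count (λ y → P y ≡ᵇ not s) →
      ∀ m → IsF (k ∸ 1) (k ∸ 1) m →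
      eInduced G (λ v → P v ≡ᵇ s) ≤ m
corollary4p4 zero    β ()
corollary4p4 (suc k) β _ = suc k + suc k * β ,
  λ n G P s Fk-free codegree large m (_ , f-maximal) →
  f-maximal n (induced G (λ v → P v ≡ᵇ s)) (partition-bounded β G P s Fk-free codegree large)
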